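{- Let $q>2$ be a prime power, $s\geq 3$ an integer, and let $\Omega$ be a non-empty family of hyperplanes of $\mathrm{PG}(s,q^2)$ such that every point lies in exactly $\frac{q^s(q^{s-1}-(-1)^{s-1})}{q+1}$ or exactly $\frac{q^{s-1}(q^s-(-1)^s)}{q+1}$ hyperplanes of $\Omega$. Call a point black if it lies in exactly $\frac{q^s(q^{s-1}-(-1)^{s-1})}{q+1}$ hyperplanes of $\Omega$. Then the number of black points of $\mathrm{PG}(s,q^2)$ equals $N_s=\frac{(q^{s+1}+(-1)^s)(q^s-(-1)^s)}{q^2-1}$.
   Context: $N_s$ is the number of points of a non-singular hermitian variety $\mathcal H(s,q^2)$. -}

module Defs where

open import Level using (Level; suc; _⊔_)
open import Data.Nat as ℕ using (ℕ; zero; _∸_; _^_)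
open import Data.Nat.DivMod using (_/_)
open import Data.Nat.Primality using (Prime)
open import Data.Bool using (Bool; if_then_else_)
open import Data.Bool using (true; false; not)
open import Data.Fin using (Fin)
open import Data.Vec using (Vec; []; _∷_; foldr; zipWith)
open import Data.Product using (Σ; ∃; _×_; _,_)
open import Data.Sum using (_⊎_)
open import Function.Bundles using (_↔_)
open import Relation.Binary.PropositionalEquality using (_≡_; _≢_)
open import Algebra.Structures using (IsCommutativeRing)

record Field : Set₁ where
  infixl 7 _*_
  infixl 6 _+_
  field
    Carrier : Set
    _+_ _*_ : Carrier → Carrier → Carrier
    -_ : Carrier → Carrier
    0# 1# : Carrier
    isCommutativeRing : IsCommutativeRing _≡_ _+_ _*_ -_ 0# 1#
    0≢1 : 0# ≢ 1#
    inverse : ∀ x → x ≢ 0# → Σ Carrier λ y → x * y ≡ 1#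

HasSize : Set → ℕ → Set
HasSize A n = A ↔ Fin n

IsPrimePower : ℕ → Set
IsPrimePower q = Σ ℕ λ p → Σ ℕ λ k → Prime p × q ≡ p ^ ℕ.suc k

module Projective (F : Field) where
  open Field F

  Normalized : ∀ {n} → Vec Carrier n → Set
  Normalized [] = Data.Empty.⊥ where import Data.Empty
  Normalized (x ∷ xs) = (x ≡ 0# × Normalized xs) ⊎ x ≡ 1#

  -- points of PG(s, F): one normalized representative of each 1-dim subspace of F^(s+1)
  Point : ℕ → Set
  Point s = Σ (Vec Carrier (ℕ.suc s)) Normalized

  -- hyperplanes of PG(s, F): normalized coefficient vectors (a_0 : … : a_s),
  -- the hyperplane being { x | a_0 x_0 + … + a_s x_s = 0 }
  Hyperplane : ℕ → Set
  Hyperplane s = Σ (Vec Carrier (ℕ.suc s)) Normalized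

  dot : ∀ {n} → Vec Carrier n → Vec Carrier n → Carrier
  dot u v = foldr _ _+_ 0# (zipWith _*_ u v)

  _∈H_ : ∀ {s} → Point s → Hyperplane s → Set
  (x , _) ∈H (a , _) = dot a x ≡ 0#

-- q^n - (-1)^n, as a natural number (q ≥ 1)
isEven : ℕ → Bool
isEven zero = true
isEven (ℕ.suc n) = not (isEven n)

qm : ℕ → ℕ → ℕ
qm q n = if isEven n then q ^ n ∸ 1 else q ^ n ℕ.+ 1

-- N_s = (q^(s+1) + (-1)^s)(q^s - (-1)^s) / (q^2 - 1)   (meaningful for q ≥ 2)
N : ℕ → ℕ → ℕ
N zero s = 0
N (ℕ.suc zero) s = 0
N q@(ℕ.suc (ℕ.suc r)) s = (qm q (ℕ.suc s) ℕ.* qm q s) / (q ℕ.* q ∸ 1)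

blackCount : ℕ → ℕ → ℕ
blackCount q s = (q ^ s ℕ.* qm q (s ∸ 1)) / ℕ.suc q

otherCount : ℕ → ℕ → ℕ
otherCount q s = (q ^ (s ∸ 1) ℕ.* qm q s) / ℕ.suc q

-- Let Q = q² and θ k = 1 + Q + ⋯ + Q^(k-1), so PG(s, Q) has θ (s+1) points, a hyperplane has θ s
-- points and two distinct hyperplanes meet in θ (s-1) points.  Counting the pairs (P, H) and the
-- triples (P, H, H′) with P ∈ H ∩ H′ and H, H′ ∈ Ω gives, for m = |Ω| and for b black and w other
-- points with degrees a and c,
--   b + w = θ (s+1),   a b + c w = m θ s,   a² b + c² w = m (m θ (s-1) + Q^(s-1)).
-- Eliminating b and w, i.e. summing (deg P - a)(deg P - c) = 0 over all points, leaves a quadratic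
-- equation for m which factors over ℤ.  Its first root forces b = N q s.  At the second root,
-- t + σ would divide (q-1)²(q+1), where t = q^(s-1) and σ = (-1)^(s-1); this is impossible because
-- t + σ is larger when s ≥ 4, and q² + 1 would have to divide 2(q-1) when s = 3.
module Submission where

open import Defs
open import Data.Nat using (ℕ; _<_; _≤_; _^_)
open import Data.Bool using (Bool; T)
open import Data.Product using (Σ; _×_)
open import Data.Sum using (_⊎_)
open import Relation.Binary.PropositionalEquality using (_≡_)
open import Data.Fin using (Fin)
open import Data.Nat.Base as ℕ using (zero; suc; s≤s)
import Data.Nat.Properties as ℕₚ
open import Function.Bundles using (_↔_)
open import Relation.Binary.PropositionalEquality using (subst)

module FiniteSums where

  open import Algebra.Definitions.RawMonoid ℕ.+-0-rawMonoid using (sum)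
  open import Data.Fin.Base as Fin using ()
  open import Data.Fin.Properties using (+↔⊎; *↔×; 1↔⊤)
  open import Data.Fin.Permutation using (↔⇒≡)
  open import Data.Nat.Base using (_+_; _*_)
  open import Data.Nat.Properties using (_≟_; *-comm; *-identityʳ; *-zeroʳ; +-identityʳ)
  open import Data.Product.Base using (_,_)
  open import Data.Product.Function.Dependent.Propositional using (Σ-↔)
  open import Data.Product.Function.NonDependent.Propositional using (_×-↔_)
  open import Data.Sum.Base using (inj₁; inj₂)
  open import Data.Sum.Function.Propositional using (_⊎-↔_)
  open import Data.Unit.Base using (⊤; tt)
  open import Function.Base using (_∘_)
  open import Function.Bundles using (Inverse; mk↔ₛ′)
  open import Function.Properties.Inverse using (↔-refl; ↔-sym; ↔-trans)
  open import Function.Related.TypeIsomorphisms using (Σ-assoc; Σ-distribˡ-⊎; Σ-distribʳ-⊎; ∃∃↔∃∃)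
  open import Relation.Binary.PropositionalEquality
  open import Relation.Nullary using (Dec; yes; no; ¬_; ¬?; Irrelevant; contradiction)
  open import Relation.Unary using (Decidable)

  private variable
    A B : Set

  -- A sum over A is specified by what it counts.  Since Fin m ↔ Fin n forces m ≡ n, this determines
  -- ∑ g, and every law below is proved by exhibiting a bijection between the counted sets.
  IsSum : {A : Set} → ((A → ℕ) → ℕ) → Set₁
  IsSum {A} ∑ = (P : A → Set) (g : A → ℕ) → (∀ x → P x ↔ Fin (g x)) → Σ A P ↔ Fin (∑ g)

  isSum-⊤ : IsSum {⊤} (λ f → f tt)
  isSum-⊤ P g P↔ = mk↔ₛ′ (λ (tt , p) → Inverse.to (P↔ tt) p) (λ i → tt , Inverse.from (P↔ tt) i)
    (Inverse.strictlyInverseˡ (P↔ tt)) (λ (tt , p) → cong (tt ,_) (Inverse.strictlyInverseʳ (P↔ tt) p))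

  isSum-⊎ : {∑₁ : (A → ℕ) → ℕ} {∑₂ : (B → ℕ) → ℕ} → IsSum ∑₁ → IsSum ∑₂ →
            IsSum {A ⊎ B} (λ f → ∑₁ (f ∘ inj₁) + ∑₂ (f ∘ inj₂))
  isSum-⊎ isSum₁ isSum₂ P g P↔ =
    ↔-trans Σ-distribʳ-⊎
      (↔-trans (isSum₁ _ _ (P↔ ∘ inj₁) ⊎-↔ isSum₂ _ _ (P↔ ∘ inj₂)) (↔-sym +↔⊎))

  isSum-× : {∑₁ : (A → ℕ) → ℕ} {∑₂ : (B → ℕ) → ℕ} → IsSum ∑₁ → IsSum ∑₂ →
            IsSum {A × B} (λ f → ∑₁ (λ a → ∑₂ (λ b → f (a , b))))
  isSum-× isSum₁ isSum₂ P g P↔ = ↔-trans Σ-assoc (isSum₁ _ _ (λ a → isSum₂ _ _ (λ b → P↔ (a , b))))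

  isSum-↔ : {∑ : (B → ℕ) → ℕ} (i : A ↔ B) → IsSum ∑ → IsSum (λ f → ∑ (f ∘ Inverse.from i))
  isSum-↔ i isSum P g P↔ =
    ↔-trans (Σ-↔ i (λ {x} → subst (λ y → P x ↔ P y) (sym (Inverse.strictlyInverseʳ i x)) ↔-refl))
            (isSum _ _ (P↔ ∘ Inverse.from i))

  sum-isSum : ∀ n → IsSum (sum {n})
  sum-isSum zero    P g P↔ = mk↔ₛ′ (λ ()) (λ ()) (λ ()) (λ ())
  sum-isSum (suc n) = isSum-↔ (↔-trans +↔⊎ (1↔⊤ ⊎-↔ ↔-refl)) (isSum-⊎ isSum-⊤ (sum-isSum n))

  𝟙 : {P : Set} → Dec P → ℕ
  𝟙 (yes _) = 1
  𝟙 (no _)  = 0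

  𝟙-↔ : {P : Set} → Irrelevant P → (P? : Dec P) → P ↔ Fin (𝟙 P?)
  𝟙-↔ irr (yes p) = mk↔ₛ′ (λ _ → Fin.zero) (λ _ → p) (λ { Fin.zero → refl ; (Fin.suc ()) }) (irr p)
  𝟙-↔ irr (no ¬p) = mk↔ₛ′ (λ p → contradiction p ¬p) (λ ()) (λ ()) (λ p → contradiction p ¬p)

  𝟙-yes : {P : Set} (P? : Dec P) → P → 𝟙 P? ≡ 1
  𝟙-yes (yes _) _ = refl
  𝟙-yes (no ¬p) p = contradiction p ¬p

  𝟙-no : {P : Set} (P? : Dec P) → ¬ P → 𝟙 P? ≡ 0
  𝟙-no (yes p) ¬p = contradiction p ¬p
  𝟙-no (no _)  _  = refl

  𝟙-idem : {P : Set} (P? : Dec P) → 𝟙 P? * 𝟙 P? ≡ 𝟙 P?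
  𝟙-idem (yes _) = refl
  𝟙-idem (no _)  = refl

  module IsSumProperties {∑ : (A → ℕ) → ℕ} (isSum : IsSum ∑) where

    ∑-card : (P : A → Set) (g : A → ℕ) → (∀ x → P x ↔ Fin (g x)) →
             ∀ {n} → Σ A P ↔ Fin n → ∑ g ≡ n
    ∑-card P g P↔ ΣP↔ = ↔⇒≡ (↔-trans (↔-sym (isSum P g P↔)) ΣP↔)

    ∑-counts : (f : A → ℕ) → Σ A (Fin ∘ f) ↔ Fin (∑ f)
    ∑-counts f = isSum (Fin ∘ f) f (λ _ → ↔-refl)

    ∑-cong : {f g : A → ℕ} → (∀ x → f x ≡ g x) → ∑ f ≡ ∑ g
    ∑-cong {f} {g} f≗g =
      ∑-card (Fin ∘ g) f (λ x → subst (λ n → Fin (g x) ↔ Fin n) (sym (f≗g x)) ↔-refl) (∑-counts g)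

    ∑-zero : ∑ (λ _ → 0) ≡ 0
    ∑-zero = ∑-card (λ _ → Fin 0) (λ _ → 0) (λ _ → ↔-refl) (mk↔ₛ′ (λ ()) (λ ()) (λ ()) (λ ()))

    ∑-distrib-+ : (f g : A → ℕ) → ∑ (λ x → f x + g x) ≡ ∑ f + ∑ g
    ∑-distrib-+ f g = ∑-card (λ x → Fin (f x) ⊎ Fin (g x)) _ (λ _ → ↔-sym +↔⊎)
      (↔-trans Σ-distribˡ-⊎ (↔-trans (∑-counts f ⊎-↔ ∑-counts g) (↔-sym +↔⊎)))

    ∑-distribˡ-* : (k : ℕ) (f : A → ℕ) → ∑ (λ x → k * f x) ≡ k * ∑ f
    ∑-distribˡ-* zero    f = ∑-zero
    ∑-distribˡ-* (suc k) f = trans (∑-distrib-+ f (λ x → k * f x)) (cong (∑ f +_) (∑-distribˡ-* k f))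

    ∑-distribʳ-* : (k : ℕ) (f : A → ℕ) → ∑ (λ x → f x * k) ≡ ∑ f * k
    ∑-distribʳ-* k f = begin
      ∑ (λ x → f x * k) ≡⟨ ∑-cong (λ x → *-comm (f x) k) ⟩
      ∑ (λ x → k * f x) ≡⟨ ∑-distribˡ-* k f ⟩
      k * ∑ f           ≡⟨ *-comm k (∑ f) ⟩
      ∑ f * k           ∎
      where open ≡-Reasoning

    ∑-const : ∀ {n} → A ↔ Fin n → (k : ℕ) → ∑ (λ _ → k) ≡ n * k
    ∑-const A↔ k =
      ∑-card (λ _ → Fin k) (λ _ → k) (λ _ → ↔-refl) (↔-trans (A↔ ×-↔ ↔-refl) (↔-sym *↔×))

    ∑-𝟙 : {P : A → Set} → (∀ x → Irrelevant (P x)) → (P? : Decidable P) → Σ A P ↔ Fin (∑ (𝟙 ∘ P?))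
    ∑-𝟙 irr P? = isSum _ _ (λ x → 𝟙-↔ (irr x) (P? x))

    ∑-𝟙-unique : {P : A → Set} → (∀ x → Irrelevant (P x)) → (P? : Decidable P) →
                 ∀ x₀ → P x₀ → (∀ y → P y → y ≡ x₀) → ∑ (𝟙 ∘ P?) ≡ 1
    ∑-𝟙-unique {P} irr P? x₀ p₀ unique = ∑-card _ _ (λ x → 𝟙-↔ (irr x) (P? x))
      (mk↔ₛ′ (λ _ → Fin.zero) (λ _ → x₀ , p₀) (λ { Fin.zero → refl ; (Fin.suc ()) }) singleton)
      where
      singleton : (y : Σ A P) → (x₀ , p₀) ≡ y
      singleton (y , p) with unique y p
      ... | refl = cong (x₀ ,_) (irr x₀ p₀ p)

    ∑-two-valued : {f : A → ℕ} {a c : ℕ} → (∀ x → f x ≡ a ⊎ f x ≡ c) → (g : ℕ → ℕ) →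
      ∑ (g ∘ f) ≡ g a * ∑ (λ x → 𝟙 (f x ≟ a)) + g c * ∑ (λ x → 𝟙 (¬? (f x ≟ a)))
    ∑-two-valued {f = f} {a} {c} two-valued g = begin
      ∑ (g ∘ f)
        ≡⟨ ∑-cong split ⟩
      ∑ (λ x → g a * 𝟙 (f x ≟ a) + g c * 𝟙 (¬? (f x ≟ a)))
        ≡⟨ ∑-distrib-+ (λ x → g a * 𝟙 (f x ≟ a)) (λ x → g c * 𝟙 (¬? (f x ≟ a))) ⟩
      ∑ (λ x → g a * 𝟙 (f x ≟ a)) + ∑ (λ x → g c * 𝟙 (¬? (f x ≟ a)))
        ≡⟨ cong₂ _+_ (∑-distribˡ-* (g a) _) (∑-distribˡ-* (g c) _) ⟩
      g a * ∑ (λ x → 𝟙 (f x ≟ a)) + g c * ∑ (λ x → 𝟙 (¬? (f x ≟ a))) ∎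
      where
      open ≡-Reasoning
      split : ∀ x → g (f x) ≡ g a * 𝟙 (f x ≟ a) + g c * 𝟙 (¬? (f x ≟ a))
      split x with f x ≟ a | two-valued x
      ... | yes refl | _         = sym (trans (cong₂ _+_ (*-identityʳ (g a)) (*-zeroʳ (g c))) (+-identityʳ (g a)))
      ... | no fx≢a  | inj₁ fx≡a = contradiction fx≡a fx≢a
      ... | no _     | inj₂ refl = sym (trans (cong (_+ g c * 1) (*-zeroʳ (g a))) (*-identityʳ (g c)))

  ∑-comm : {∑ : (A → ℕ) → ℕ} {∑′ : (B → ℕ) → ℕ} → IsSum ∑ → IsSum ∑′ →
           (f : A → B → ℕ) → ∑ (λ a → ∑′ (λ b → f a b)) ≡ ∑′ (λ b → ∑ (λ a → f a b))
  ∑-comm isSum isSum′ f = ∑-card (λ a → Σ _ (λ b → Fin (f a b))) _ (λ a → isSum′ _ (f a) (λ _ → ↔-refl))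
    (↔-trans (∃∃↔∃∃ (λ a b → Fin (f a b))) (isSum′ _ _ (λ b → ∑-counts (λ a → f a b))))
    where open IsSumProperties isSum

  ∑-*-∑ : {∑ : (A → ℕ) → ℕ} {∑′ : (B → ℕ) → ℕ} → IsSum ∑ → IsSum ∑′ →
          (f : A → ℕ) (g : B → ℕ) → ∑ f * ∑′ g ≡ ∑ (λ a → ∑′ (λ b → f a * g b))
  ∑-*-∑ {∑ = ∑} {∑′} isSum isSum′ f g = begin
    ∑ f * ∑′ g                      ≡⟨ ∑-distribʳ-* (∑′ g) f ⟨
    ∑ (λ a → f a * ∑′ g)            ≡⟨ ∑-cong (λ a → IsSumProperties.∑-distribˡ-* isSum′ (f a) g) ⟨
    ∑ (λ a → ∑′ (λ b → f a * g b))  ∎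
    where
    open ≡-Reasoning
    open IsSumProperties isSum

open FiniteSums

geometricSum : ℕ → ℕ → ℕ
geometricSum Q zero    = 0
geometricSum Q (suc k) = geometricSum Q k ℕ.+ Q ^ k

module LinearAlgebra (F : Field) where

  open import Algebra.Bundles using (CommutativeRing)
  import Algebra.Properties.CommutativeSemigroup as CommutativeSemigroupProperties
  import Algebra.Properties.Group as GroupProperties
  import Algebra.Properties.Ring as RingProperties
  open import Data.Product.Base using (_,_; proj₁; proj₂)
  open import Data.Sum.Base using (inj₁; inj₂)
  open import Data.Vec.Base using (Vec; []; _∷_; map; zipWith; replicate)
  open import Data.Vec.Properties using (∷-injectiveˡ; ∷-injectiveʳ)
  open import Function.Base using (_∘′_)
  open import Level using (0ℓ)
  open import Relation.Binary.PropositionalEquality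

  open Field F
  open Projective F using (Normalized; dot)

  ring : CommutativeRing 0ℓ 0ℓ
  ring = record { isCommutativeRing = isCommutativeRing }

  open CommutativeRing ring
    using (+-identityˡ; +-identityʳ; -‿inverseʳ; *-assoc; *-comm; *-identityˡ; *-identityʳ;
           distribˡ; distribʳ; zeroˡ; zeroʳ; +-group; +-commutativeSemigroup)
  open GroupProperties +-group using (inverseʳ-unique; x∙y⁻¹≈ε⇒x≈y)
  open CommutativeSemigroupProperties +-commutativeSemigroup using (interchange)
  open RingProperties (CommutativeRing.ring ring) using (-1*x≈-x)

  private variable
    n : ℕ

  0ᵥ : ∀ n → Vec Carrier n
  0ᵥ n = replicate n 0#

  infixl 6 _+ᵥ_
  infixl 7 _·ᵥ_

  _+ᵥ_ : Vec Carrier n → Vec Carrier n → Vec Carrier n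
  _+ᵥ_ = zipWith _+_

  _·ᵥ_ : Carrier → Vec Carrier n → Vec Carrier n
  μ ·ᵥ v = map (μ *_) v

  dot-0ᵥ : (x : Vec Carrier n) → dot (0ᵥ n) x ≡ 0#
  dot-0ᵥ []       = refl
  dot-0ᵥ (x ∷ xs) = trans (cong₂ _+_ (zeroˡ x) (dot-0ᵥ xs)) (+-identityʳ 0#)

  dot-+ᵥ-·ᵥ : ∀ μ (a b x : Vec Carrier n) → dot (a +ᵥ μ ·ᵥ b) x ≡ dot a x + μ * dot b x
  dot-+ᵥ-·ᵥ μ [] [] [] = sym (trans (cong (0# +_) (zeroʳ μ)) (+-identityʳ 0#))
  dot-+ᵥ-·ᵥ μ (a ∷ as) (b ∷ bs) (x ∷ xs) = begin
    (a + μ * b) * x + dot (as +ᵥ μ ·ᵥ bs) xs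
      ≡⟨ cong₂ _+_ (distribʳ x a (μ * b)) (dot-+ᵥ-·ᵥ μ as bs xs) ⟩
    (a * x + μ * b * x) + (dot as xs + μ * dot bs xs)
      ≡⟨ cong (λ y → (a * x + y) + (dot as xs + μ * dot bs xs)) (*-assoc μ b x) ⟩
    (a * x + μ * (b * x)) + (dot as xs + μ * dot bs xs)
      ≡⟨ interchange (a * x) (μ * (b * x)) (dot as xs) (μ * dot bs xs) ⟩
    (a * x + dot as xs) + (μ * (b * x) + μ * dot bs xs)
      ≡⟨ cong ((a * x + dot as xs) +_) (distribˡ μ (b * x) (dot bs xs)) ⟨
    (a * x + dot as xs) + μ * (b * x + dot bs xs) ∎
    where open ≡-Reasoning

  Normalized⇒≢0ᵥ : ∀ {v : Vec Carrier n} → Normalized v → v ≢ 0ᵥ n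
  Normalized⇒≢0ᵥ {v = _ ∷ _} (inj₁ (_ , nv)) v≡0 = Normalized⇒≢0ᵥ nv (∷-injectiveʳ v≡0)
  Normalized⇒≢0ᵥ {v = _ ∷ _} (inj₂ x≡1)     v≡0 = 0≢1 (trans (sym (∷-injectiveˡ v≡0)) x≡1)

  +ᵥ-0·ᵥ : (a b : Vec Carrier n) → a +ᵥ 0# ·ᵥ b ≡ a
  +ᵥ-0·ᵥ []       []       = refl
  +ᵥ-0·ᵥ (a ∷ as) (b ∷ bs) = cong₂ _∷_ (trans (cong (a +_) (zeroˡ b)) (+-identityʳ a)) (+ᵥ-0·ᵥ as bs)

  +ᵥ-·ᵥ-≡0ᵥ⇒≡ : ∀ {μ} → 1# + μ ≡ 0# → (a b : Vec Carrier n) → a +ᵥ μ ·ᵥ b ≡ 0ᵥ n → a ≡ b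
  +ᵥ-·ᵥ-≡0ᵥ⇒≡ 1+μ≡0 [] [] _ = refl
  +ᵥ-·ᵥ-≡0ᵥ⇒≡ {μ = μ} 1+μ≡0 (a ∷ as) (b ∷ bs) eq =
    cong₂ _∷_ (x∙y⁻¹≈ε⇒x≈y a b a-b≡0) (+ᵥ-·ᵥ-≡0ᵥ⇒≡ 1+μ≡0 as bs (∷-injectiveʳ eq))
    where
    a-b≡0 : a + - b ≡ 0#
    a-b≡0 = begin
      a + - b       ≡⟨ cong (a +_) (-1*x≈-x b) ⟨
      a + - 1# * b  ≡⟨ cong (λ ν → a + ν * b) (inverseʳ-unique 1# μ 1+μ≡0) ⟨
      a + μ * b     ≡⟨ ∷-injectiveˡ eq ⟩
      0#            ∎
      where open ≡-Reasoning

  pencil-≢0ᵥ : ∀ {a b : Vec Carrier n} → Normalized a → Normalized b → a ≢ b →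
               ∀ μ → a +ᵥ μ ·ᵥ b ≢ 0ᵥ n
  pencil-≢0ᵥ {a = _ ∷ as} {_ ∷ bs} (inj₁ (refl , na)) (inj₁ (refl , nb)) a≢b μ eq =
    pencil-≢0ᵥ na nb (a≢b ∘′ cong (0# ∷_)) μ (∷-injectiveʳ eq)
  pencil-≢0ᵥ {a = _ ∷ as} {_ ∷ bs} (inj₁ (refl , na)) (inj₂ refl) _ μ eq =
    Normalized⇒≢0ᵥ na
      (trans (sym (+ᵥ-0·ᵥ as bs)) (subst (λ ν → as +ᵥ ν ·ᵥ bs ≡ 0ᵥ _) μ≡0 (∷-injectiveʳ eq)))
    where
    μ≡0 : μ ≡ 0#
    μ≡0 = trans (sym (*-identityʳ μ)) (trans (sym (+-identityˡ _)) (∷-injectiveˡ eq))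
  pencil-≢0ᵥ {a = _ ∷ as} {_ ∷ bs} (inj₂ refl) (inj₁ (refl , nb)) _ μ eq =
    0≢1 (sym (trans (sym (+-identityʳ 1#)) (trans (cong (1# +_) (sym (zeroʳ μ))) (∷-injectiveˡ eq))))
  pencil-≢0ᵥ {a = _ ∷ as} {_ ∷ bs} (inj₂ refl) (inj₂ refl) a≢b μ eq =
    a≢b (cong (1# ∷_) (+ᵥ-·ᵥ-≡0ᵥ⇒≡ 1+μ≡0 as bs (∷-injectiveʳ eq)))
    where
    1+μ≡0 : 1# + μ ≡ 0#
    1+μ≡0 = trans (cong (1# +_) (sym (*-identityʳ μ))) (∷-injectiveˡ eq)

  module LinearEquation (e d : Carrier) (d≢0 : d ≢ 0#) where

    private
      d⁻¹ = proj₁ (inverse d d≢0)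
      d*d⁻¹≡1 = proj₂ (inverse d d≢0)

    solution : Carrier
    solution = d⁻¹ * - e

    solution-solves : e + d * solution ≡ 0#
    solution-solves = begin
      e + d * (d⁻¹ * - e)  ≡⟨ cong (e +_) (*-assoc d d⁻¹ (- e)) ⟨
      e + d * d⁻¹ * - e    ≡⟨ cong (λ u → e + u * - e) d*d⁻¹≡1 ⟩
      e + 1# * - e         ≡⟨ cong (e +_) (*-identityˡ (- e)) ⟩
      e + - e              ≡⟨ -‿inverseʳ e ⟩
      0#                   ∎
      where open ≡-Reasoning

    solution-unique : ∀ y → e + d * y ≡ 0# → y ≡ solution
    solution-unique y e+dy≡0 = begin
      y              ≡⟨ *-identityˡ y ⟨
      1# * y         ≡⟨ cong (_* y) (trans (sym d*d⁻¹≡1) (*-comm d d⁻¹)) ⟩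
      d⁻¹ * d * y    ≡⟨ *-assoc d⁻¹ d y ⟩
      d⁻¹ * (d * y)  ≡⟨ cong (d⁻¹ *_) (inverseʳ-unique e (d * y) e+dy≡0) ⟩
      d⁻¹ * - e      ∎
      where open ≡-Reasoning

module ProjectiveCounting (F : Field) {Q : ℕ} (|F| : HasSize (Field.Carrier F) Q) where

  open import Algebra.Bundles using (CommutativeRing)
  open import Algebra.Definitions.RawMonoid ℕ.+-0-rawMonoid using (sum)
  open import Axiom.UniquenessOfIdentityProofs using (module Decidable⇒UIP)
  open import Data.Bool.Properties using (T?; T-irrelevant)
  import Data.Fin.Properties as Fin
  open import Data.Nat.Base using (_+_; _*_; NonZero)
  open import Data.Nat.Properties
    using (+-comm; *-assoc; *-identityˡ; *-identityʳ; *-zeroʳ; +-identityʳ; *-cancelˡ-≡; +-cancelˡ-≡; +-cancelʳ-≡)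
  open import Data.Nat.Tactic.RingSolver using (solve-∀)
  open import Data.Product.Base using (_,_; proj₁; uncurry)
  open import Data.Product.Function.NonDependent.Propositional using (_×-↔_)
  open import Data.Sum.Base using (inj₁; inj₂; [_,_]′)
  open import Data.Unit.Base using (⊤)
  open import Data.Vec.Base using (Vec; []; _∷_)
  import Data.Vec.Properties as Vec
  open import Function.Base using (_∘_)
  open import Function.Bundles using (Inverse; mk↔ₛ′)
  open import Function.Properties.Inverse using (↔-sym; ↔-trans; ↔⇒↣)
  open import Relation.Binary.Definitions using (DecidableEquality)
  open import Relation.Binary.PropositionalEquality
  open import Relation.Nullary using (yes; no; ¬?; Irrelevant; contradiction)
  open import Relation.Nullary.Decidable using (via-injection)

  open Field F using (Carrier; 0#; 1#; 0≢1) renaming (_+_ to _⊕_; _*_ to _⊗_)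
  open Projective F
  open LinearAlgebra F
  open CommutativeRing ring using () renaming
    (+-assoc to ⊕-assoc; +-identityʳ to ⊕-identityʳ; +-identityˡ to ⊕-identityˡ;
     *-identityʳ to ⊗-identityʳ; *-comm to ⊗-comm; zeroʳ to ⊗-zeroʳ)

  private variable
    k n : ℕ

  θ : ℕ → ℕ
  θ = geometricSum Q

  instance
    Q-nonZero : NonZero Q
    Q-nonZero = Fin.nonZeroIndex (Inverse.to |F| 0#)

  infix 4 _≟_ _≟ᵥ_

  _≟_ : DecidableEquality Carrier
  _≟_ = via-injection (↔⇒↣ |F|) Fin._≟_

  _≟ᵥ_ : DecidableEquality (Vec Carrier n)
  _≟ᵥ_ = Vec.≡-dec _≟_

  Normalized-irrelevant : (v : Vec Carrier n) → Irrelevant (Normalized v)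
  Normalized-irrelevant (x ∷ v) (inj₁ (p , n)) (inj₁ (p′ , n′)) =
    cong₂ (λ p n → inj₁ (p , n)) (Decidable⇒UIP.≡-irrelevant _≟_ p p′) (Normalized-irrelevant v n n′)
  Normalized-irrelevant (x ∷ v) (inj₁ (x≡0 , _)) (inj₂ x≡1) = contradiction (trans (sym x≡0) x≡1) 0≢1
  Normalized-irrelevant (x ∷ v) (inj₂ x≡1) (inj₁ (x≡0 , _)) = contradiction (trans (sym x≡0) x≡1) 0≢1
  Normalized-irrelevant (x ∷ v) (inj₂ p) (inj₂ p′) = cong inj₂ (Decidable⇒UIP.≡-irrelevant _≟_ p p′)

  Point-≡ : (P P′ : Point k) → proj₁ P ≡ proj₁ P′ → P ≡ P′
  Point-≡ (v , n) (.v , n′) refl = cong (v ,_) (Normalized-irrelevant v n n′)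

  𝟙≡0 : Carrier → ℕ
  𝟙≡0 u = 𝟙 (u ≟ 0#)

  incidence : Vec Carrier (suc k) → Point k → ℕ
  incidence c P = 𝟙≡0 (dot c (proj₁ P))

  ∑F : (Carrier → ℕ) → ℕ
  ∑F f = sum (f ∘ Inverse.from |F|)

  ∑F-isSum : IsSum ∑F
  ∑F-isSum = isSum-↔ |F| (sum-isSum Q)

  ∑V : ∀ k → (Vec Carrier k → ℕ) → ℕ
  ∑V zero    f = f []
  ∑V (suc k) f = ∑F (λ x → ∑V k (f ∘ (x ∷_)))

  ∑V-isSum : ∀ k → IsSum (∑V k)
  ∑V-isSum zero    = isSum-↔ (mk↔ₛ′ _ (λ _ → []) (λ _ → refl) (λ { [] → refl })) isSum-⊤
  ∑V-isSum (suc k) = isSum-↔ Vec-suc↔× (isSum-× ∑F-isSum (∑V-isSum k))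
    where
    Vec-suc↔× : Vec Carrier (suc k) ↔ (Carrier × Vec Carrier k)
    Vec-suc↔× = mk↔ₛ′ (λ { (x ∷ xs) → x , xs }) (uncurry _∷_) (λ _ → refl) (λ { (_ ∷ _) → refl })

  point₀ : Point 0
  point₀ = (1# ∷ []) , inj₂ refl

  atInfinity : Point k → Point (suc k)
  atInfinity (x , n) = (0# ∷ x) , inj₁ (refl , n)

  affinePoint : Vec Carrier (suc k) → Point (suc k)
  affinePoint x = (1# ∷ x) , inj₂ refl

  -- PG(k+1) is the hyperplane x₀ = 0, a copy of PG(k), together with the affine points (1, x).
  ∑P : ∀ k → (Point k → ℕ) → ℕ
  ∑P zero    f = f point₀
  ∑P (suc k) f = ∑P k (f ∘ atInfinity) + ∑V (suc k) (f ∘ affinePoint)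

  Point-0↔⊤ : Point 0 ↔ ⊤
  Point-0↔⊤ = mk↔ₛ′ _ (λ _ → point₀) (λ _ → refl) λ where
    ((_ ∷ []) , inj₁ (_ , ()))
    ((_ ∷ []) , inj₂ refl) → refl

  Point-suc↔⊎ : Point (suc k) ↔ (Point k ⊎ Vec Carrier (suc k))
  Point-suc↔⊎ = mk↔ₛ′ to [ atInfinity , affinePoint ]′ to∘from from∘to
    where
    to : Point (suc k) → Point k ⊎ Vec Carrier (suc k)
    to ((_ ∷ x) , inj₁ (_ , n)) = inj₁ (x , n)
    to ((_ ∷ x) , inj₂ _)       = inj₂ x
    to∘from : ∀ y → to ([ atInfinity , affinePoint ]′ y) ≡ y
    to∘from (inj₁ _) = refl
    to∘from (inj₂ _) = refl
    from∘to : ∀ P → [ atInfinity , affinePoint ]′ (to P) ≡ P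
    from∘to ((_ ∷ _) , inj₁ (refl , _)) = refl
    from∘to ((_ ∷ _) , inj₂ refl)       = refl

  ∑P-isSum : ∀ k → IsSum (∑P k)
  ∑P-isSum zero    = isSum-↔ Point-0↔⊤ isSum-⊤
  ∑P-isSum (suc k) = isSum-↔ Point-suc↔⊎ (isSum-⊎ (∑P-isSum k) (∑V-isSum (suc k)))

  module ∑F = IsSumProperties ∑F-isSum
  module ∑V k = IsSumProperties (∑V-isSum k)
  module ∑P k = IsSumProperties (∑P-isSum k)

  ∑V-const : ∀ k c → ∑V k (λ _ → c) ≡ Q ^ k * c
  ∑V-const zero    c = sym (+-identityʳ c)
  ∑V-const (suc k) c = begin
    ∑F (λ _ → ∑V k (λ _ → c)) ≡⟨ ∑F.∑-cong (λ _ → ∑V-const k c) ⟩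
    ∑F (λ _ → Q ^ k * c)      ≡⟨ ∑F.∑-const |F| (Q ^ k * c) ⟩
    Q * (Q ^ k * c)           ≡⟨ *-assoc Q (Q ^ k) c ⟨
    Q ^ suc k * c             ∎
    where open ≡-Reasoning

  points-count : ∀ k → ∑P k (λ _ → 1) ≡ θ (suc k)
  points-count zero    = refl
  points-count (suc k) = cong₂ _+_ (points-count k) (trans (∑V-const (suc k) 1) (*-identityʳ _))

  linear-equation-count : ∀ e {d} → d ≢ 0# → ∑F (λ y → 𝟙≡0 (e ⊕ d ⊗ y)) ≡ 1
  linear-equation-count e {d} d≢0 = ∑F.∑-𝟙-unique (λ _ → Decidable⇒UIP.≡-irrelevant _≟_)
    (λ y → e ⊕ d ⊗ y ≟ 0#) solution solution-solves solution-unique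
    where open LinearEquation e d d≢0

  solutions : ∀ k → Carrier → Vec Carrier k → ℕ
  solutions k e c = ∑V k (λ x → 𝟙≡0 (e ⊕ dot c x))

  solutions-∷ : ∀ e d (c : Vec Carrier k) →
                solutions (suc k) e (d ∷ c) ≡ ∑F (λ y → solutions k (e ⊕ d ⊗ y) c)
  solutions-∷ {k} e d c =
    ∑F.∑-cong λ y → ∑V.∑-cong k λ x → cong 𝟙≡0 (sym (⊕-assoc e (d ⊗ y) (dot c x)))

  solutions-0ᵥ : ∀ k e → solutions k e (0ᵥ k) ≡ Q ^ k * 𝟙≡0 e
  solutions-0ᵥ k e = trans
    (∑V.∑-cong k λ x → cong 𝟙≡0 (trans (cong (e ⊕_) (dot-0ᵥ x)) (⊕-identityʳ e)))
    (∑V-const k (𝟙≡0 e))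

  solutions-leading : ∀ k e {d} → d ≢ 0# → solutions (suc k) e (d ∷ 0ᵥ k) ≡ Q ^ k
  solutions-leading k e {d} d≢0 = begin
    solutions (suc k) e (d ∷ 0ᵥ k)
      ≡⟨ solutions-∷ e d (0ᵥ k) ⟩
    ∑F (λ y → solutions k (e ⊕ d ⊗ y) (0ᵥ k))
      ≡⟨ ∑F.∑-cong (λ y → solutions-0ᵥ k (e ⊕ d ⊗ y)) ⟩
    ∑F (λ y → Q ^ k * 𝟙≡0 (e ⊕ d ⊗ y))
      ≡⟨ ∑F.∑-distribˡ-* (Q ^ k) (λ y → 𝟙≡0 (e ⊕ d ⊗ y)) ⟩
    Q ^ k * ∑F (λ y → 𝟙≡0 (e ⊕ d ⊗ y))
      ≡⟨ cong (Q ^ k *_) (linear-equation-count e d≢0) ⟩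
    Q ^ k * 1
      ≡⟨ *-identityʳ (Q ^ k) ⟩
    Q ^ k ∎
    where open ≡-Reasoning

  solutions-≢0ᵥ : ∀ k e (c : Vec Carrier (suc k)) → c ≢ 0ᵥ (suc k) → solutions (suc k) e c ≡ Q ^ k
  solutions-≢0ᵥ zero    e (d ∷ []) c≢0 = solutions-leading 0 e (c≢0 ∘ cong (_∷ []))
  solutions-≢0ᵥ (suc k) e (d ∷ c) dc≢0 with c ≟ᵥ 0ᵥ (suc k)
  ... | yes refl = solutions-leading (suc k) e (dc≢0 ∘ cong (_∷ 0ᵥ (suc k)))
  ... | no c≢0   = begin
    solutions (suc (suc k)) e (d ∷ c)
      ≡⟨ solutions-∷ e d c ⟩
    ∑F (λ y → solutions (suc k) (e ⊕ d ⊗ y) c)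
      ≡⟨ ∑F.∑-cong (λ y → solutions-≢0ᵥ k (e ⊕ d ⊗ y) c c≢0) ⟩
    ∑F (λ _ → Q ^ k)
      ≡⟨ ∑F.∑-const |F| (Q ^ k) ⟩
    Q ^ suc k ∎
    where open ≡-Reasoning

  incidence-∷ : ∀ d (c : Vec Carrier (suc k)) →
                ∑P (suc k) (incidence (d ∷ c)) ≡ ∑P k (incidence c) + solutions (suc k) d c
  incidence-∷ {k} d c = cong₂ _+_
    (∑P.∑-cong k λ P → cong 𝟙≡0 (trans (cong (_⊕ dot c (proj₁ P)) (⊗-zeroʳ d)) (⊕-identityˡ _)))
    (∑V.∑-cong (suc k) λ x → cong (λ u → 𝟙≡0 (u ⊕ dot c x)) (⊗-identityʳ d))

  hyperplane-points-count : ∀ k (c : Vec Carrier (suc k)) → c ≢ 0ᵥ (suc k) → ∑P k (incidence c) ≡ θ k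
  hyperplane-points-count zero    (d ∷ []) c≢0 =
    𝟙-no (d ⊗ 1# ⊕ 0# ≟ 0#) (c≢0 ∘ cong (_∷ []) ∘ trans (sym (trans (⊕-identityʳ _) (⊗-identityʳ d))))
  hyperplane-points-count (suc k) (d ∷ c) dc≢0 with c ≟ᵥ 0ᵥ (suc k)
  ... | yes refl = begin
    ∑P (suc k) (incidence (d ∷ 0ᵥ (suc k)))
      ≡⟨ incidence-∷ d (0ᵥ (suc k)) ⟩
    ∑P k (incidence (0ᵥ (suc k))) + solutions (suc k) d (0ᵥ (suc k))
      ≡⟨ cong₂ _+_ (∑P.∑-cong k (λ P → 𝟙-yes (_ ≟ 0#) (dot-0ᵥ (proj₁ P)))) (solutions-0ᵥ (suc k) d) ⟩
    ∑P k (λ _ → 1) + Q ^ suc k * 𝟙≡0 d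
      ≡⟨ cong₂ _+_ (points-count k) (cong (Q ^ suc k *_) (𝟙-no (d ≟ 0#) (dc≢0 ∘ cong (_∷ 0ᵥ (suc k))))) ⟩
    θ (suc k) + Q ^ suc k * 0
      ≡⟨ cong (θ (suc k) +_) (*-zeroʳ (Q ^ suc k)) ⟩
    θ (suc k) + 0
      ≡⟨ +-identityʳ (θ (suc k)) ⟩
    θ (suc k) ∎
    where open ≡-Reasoning
  ... | no c≢0 =
    trans (incidence-∷ d c) (cong₂ _+_ (hyperplane-points-count k c c≢0) (solutions-≢0ᵥ k d c c≢0))

  -- A point off b lies on exactly one of the hyperplanes a + μ b; a point on b lies on all of them
  -- or on none, according as it lies on a.
  pencil-incidence : ∀ (a b : Vec Carrier (suc k)) P →
    incidence b P + ∑F (λ μ → incidence (a +ᵥ μ ·ᵥ b) P) ≡ Q * (incidence a P * incidence b P) + 1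
  pencil-incidence a b (x , _) with dot b x ≟ 0#
  ... | yes b·x≡0 = begin
    1 + ∑F (λ μ → 𝟙≡0 (dot (a +ᵥ μ ·ᵥ b) x))  ≡⟨ cong (1 +_) (∑F.∑-cong (cong 𝟙≡0 ∘ on-b)) ⟩
    1 + ∑F (λ _ → 𝟙≡0 (dot a x))              ≡⟨ cong (1 +_) (∑F.∑-const |F| (𝟙≡0 (dot a x))) ⟩
    1 + Q * 𝟙≡0 (dot a x)                     ≡⟨ +-comm 1 (Q * 𝟙≡0 (dot a x)) ⟩
    Q * 𝟙≡0 (dot a x) + 1                     ≡⟨ cong (λ n → Q * n + 1) (*-identityʳ (𝟙≡0 (dot a x))) ⟨
    Q * (𝟙≡0 (dot a x) * 1) + 1               ∎
    where
    open ≡-Reasoning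
    on-b : ∀ μ → dot (a +ᵥ μ ·ᵥ b) x ≡ dot a x
    on-b μ = begin
      dot (a +ᵥ μ ·ᵥ b) x      ≡⟨ dot-+ᵥ-·ᵥ μ a b x ⟩
      dot a x ⊕ μ ⊗ dot b x    ≡⟨ cong (λ u → dot a x ⊕ μ ⊗ u) b·x≡0 ⟩
      dot a x ⊕ μ ⊗ 0#         ≡⟨ cong (dot a x ⊕_) (⊗-zeroʳ μ) ⟩
      dot a x ⊕ 0#             ≡⟨ ⊕-identityʳ (dot a x) ⟩
      dot a x                  ∎
  ... | no b·x≢0 = begin
    0 + ∑F (λ μ → 𝟙≡0 (dot (a +ᵥ μ ·ᵥ b) x))
      ≡⟨ ∑F.∑-cong (λ μ → cong 𝟙≡0 (trans (dot-+ᵥ-·ᵥ μ a b x) (cong (dot a x ⊕_) (⊗-comm μ _)))) ⟩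
    ∑F (λ μ → 𝟙≡0 (dot a x ⊕ dot b x ⊗ μ))
      ≡⟨ linear-equation-count (dot a x) b·x≢0 ⟩
    1
      ≡⟨ cong (_+ 1) (trans (cong (Q *_) (*-zeroʳ (𝟙≡0 (dot a x)))) (*-zeroʳ Q)) ⟨
    Q * (𝟙≡0 (dot a x) * 0) + 1 ∎
    where open ≡-Reasoning

  two-hyperplanes-points-count : ∀ r {a b : Vec Carrier (suc (suc r))} → Normalized a → Normalized b →
    a ≢ b → ∑P (suc r) (λ P → incidence a P * incidence b P) ≡ θ r
  two-hyperplanes-points-count r {a} {b} na nb a≢b =
    +-cancelʳ-≡ (Q ^ r) X (θ r)
      (sym (*-cancelˡ-≡ (θ s) (X + Q ^ r) Q (+-cancelˡ-≡ (θ s) _ _ θs+Qθs≡θs+Q[X+Qʳ])))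
    where
    s = suc r
    X = ∑P s (λ P → incidence a P * incidence b P)
    rearrange : ∀ q x t p → q * x + (t + q * p) ≡ t + q * (x + p)
    rearrange = solve-∀
    pencil-sum : θ s + Q * θ s ≡ Q * X + θ (suc s)
    pencil-sum = begin
      θ s + Q * θ s
        ≡⟨ cong₂ _+_ (hyperplane-points-count s b (Normalized⇒≢0ᵥ nb))
                     (trans (∑F.∑-cong λ μ → hyperplane-points-count s _ (pencil-≢0ᵥ na nb a≢b μ))
                            (∑F.∑-const |F| (θ s))) ⟨
      ∑P s (incidence b) + ∑F (λ μ → ∑P s (incidence (a +ᵥ μ ·ᵥ b)))
        ≡⟨ cong (∑P s (incidence b) +_) (∑-comm (∑P-isSum s) ∑F-isSum λ P μ → incidence (a +ᵥ μ ·ᵥ b) P) ⟨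
      ∑P s (incidence b) + ∑P s (λ P → ∑F (λ μ → incidence (a +ᵥ μ ·ᵥ b) P))
        ≡⟨ ∑P.∑-distrib-+ s (incidence b) (λ P → ∑F (λ μ → incidence (a +ᵥ μ ·ᵥ b) P)) ⟨
      ∑P s (λ P → incidence b P + ∑F (λ μ → incidence (a +ᵥ μ ·ᵥ b) P))
        ≡⟨ ∑P.∑-cong s (pencil-incidence a b) ⟩
      ∑P s (λ P → Q * (incidence a P * incidence b P) + 1)
        ≡⟨ ∑P.∑-distrib-+ s (λ P → Q * (incidence a P * incidence b P)) (λ _ → 1) ⟩
      ∑P s (λ P → Q * (incidence a P * incidence b P)) + ∑P s (λ _ → 1)
        ≡⟨ cong₂ _+_ (∑P.∑-distribˡ-* s Q (λ P → incidence a P * incidence b P)) (points-count s) ⟩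
      Q * X + θ (suc s) ∎
      where open ≡-Reasoning
    θs+Qθs≡θs+Q[X+Qʳ] : θ s + Q * θ s ≡ θ s + Q * (X + Q ^ r)
    θs+Qθs≡θs+Q[X+Qʳ] = trans pencil-sum (rearrange Q X (θ s) (Q ^ r))
  module DoubleCounting {r : ℕ} (Ω : Hyperplane (suc r) → Bool) (deg : Point (suc r) → ℕ)
    (deg-counts : ∀ P → HasSize (Σ (Hyperplane (suc r)) (λ H → T (Ω H) × P ∈H H)) (deg P)) where

    private
      s = suc r

    ω : Hyperplane s → ℕ
    ω H = 𝟙 (T? (Ω H))

    m : ℕ
    m = ∑P s ω

    ι : Hyperplane s → Point s → ℕ
    ι H P = ω H * incidence (proj₁ H) P

    δ : Hyperplane s → Hyperplane s → ℕ
    δ H H′ = 𝟙 (proj₁ H ≟ᵥ proj₁ H′)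

    deg-≡-∑ι : ∀ P → deg P ≡ ∑P s (λ H → ι H P)
    deg-≡-∑ι P = sym (∑P.∑-card s _ _ ι-counts (deg-counts P))
      where
      ι-counts : ∀ H → (T (Ω H) × P ∈H H) ↔ Fin (ι H P)
      ι-counts H =
        ↔-trans (𝟙-↔ T-irrelevant (T? (Ω H)) ×-↔ 𝟙-↔ (Decidable⇒UIP.≡-irrelevant _≟_) _)
                (↔-sym Fin.*↔×)

    ∑-deg : ∑P s deg ≡ m * θ s
    ∑-deg = begin
      ∑P s deg                         ≡⟨ ∑P.∑-cong s deg-≡-∑ι ⟩
      ∑P s (λ P → ∑P s (λ H → ι H P))  ≡⟨ ∑-comm (∑P-isSum s) (∑P-isSum s) (λ P H → ι H P) ⟩
      ∑P s (λ H → ∑P s (ι H))          ≡⟨ ∑P.∑-cong s ∑ι ⟩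
      ∑P s (λ H → ω H * θ s)           ≡⟨ ∑P.∑-distribʳ-* s (θ s) ω ⟩
      m * θ s                          ∎
      where
      open ≡-Reasoning
      ∑ι : ∀ H → ∑P s (ι H) ≡ ω H * θ s
      ∑ι (v , nv) = trans (∑P.∑-distribˡ-* s (ω (v , nv)) (incidence v))
                            (cong (ω (v , nv) *_) (hyperplane-points-count s v (Normalized⇒≢0ᵥ nv)))

    meet : ∀ H H′ →
           ∑P s (λ P → incidence (proj₁ H) P * incidence (proj₁ H′) P) ≡ θ r + δ H H′ * Q ^ r
    meet (v , nv) (v′ , nv′) with v ≟ᵥ v′
    ... | yes refl = begin
      ∑P s (λ P → incidence v P * incidence v P) ≡⟨ ∑P.∑-cong s (λ P → 𝟙-idem (dot v (proj₁ P) ≟ 0#)) ⟩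
      ∑P s (incidence v)                         ≡⟨ hyperplane-points-count s v (Normalized⇒≢0ᵥ nv) ⟩
      θ r + Q ^ r                                ≡⟨ cong (θ r +_) (*-identityˡ (Q ^ r)) ⟨
      θ r + 1 * Q ^ r                            ∎
      where open ≡-Reasoning
    ... | no v≢v′ = trans (two-hyperplanes-points-count r nv nv′ v≢v′) (sym (+-identityʳ (θ r)))

    ∑-δ : ∀ H → ∑P s (λ H′ → ω H′ * δ H H′) ≡ ω H
    ∑-δ H = begin
      ∑P s (λ H′ → ω H′ * δ H H′) ≡⟨ ∑P.∑-cong s ω-on-diagonal ⟩
      ∑P s (λ H′ → ω H * δ H H′)  ≡⟨ ∑P.∑-distribˡ-* s (ω H) (δ H) ⟩
      ω H * ∑P s (δ H)            ≡⟨ cong (ω H *_) δ-unique ⟩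
      ω H * 1                     ≡⟨ *-identityʳ (ω H) ⟩
      ω H                         ∎
      where
      open ≡-Reasoning
      δ-unique : ∑P s (δ H) ≡ 1
      δ-unique = ∑P.∑-𝟙-unique s (λ _ → Decidable⇒UIP.≡-irrelevant _≟ᵥ_) (λ H′ → proj₁ H ≟ᵥ proj₁ H′)
                   H refl (λ H′ H≡H′ → sym (Point-≡ H H′ H≡H′))
      ω-on-diagonal : ∀ H′ → ω H′ * δ H H′ ≡ ω H * δ H H′
      ω-on-diagonal H′ with proj₁ H ≟ᵥ proj₁ H′
      ... | yes H≡H′ = cong (λ H″ → ω H″ * 1) (sym (Point-≡ H H′ H≡H′))
      ... | no _     = trans (*-zeroʳ (ω H′)) (sym (*-zeroʳ (ω H)))

    pair-count : ∀ H H′ → ∑P s (λ P → ι H P * ι H′ P) ≡ ω H * ω H′ * (θ r + δ H H′ * Q ^ r)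
    pair-count H H′ = begin
      ∑P s (λ P → ι H P * ι H′ P)
        ≡⟨ ∑P.∑-cong s (λ P → interchange (ω H) (incidence (proj₁ H) P) (ω H′) (incidence (proj₁ H′) P)) ⟩
      ∑P s (λ P → ω H * ω H′ * (incidence (proj₁ H) P * incidence (proj₁ H′) P))
        ≡⟨ ∑P.∑-distribˡ-* s (ω H * ω H′) (λ P → incidence (proj₁ H) P * incidence (proj₁ H′) P) ⟩
      ω H * ω H′ * ∑P s (λ P → incidence (proj₁ H) P * incidence (proj₁ H′) P)
        ≡⟨ cong (ω H * ω H′ *_) (meet H H′) ⟩
      ω H * ω H′ * (θ r + δ H H′ * Q ^ r) ∎
      where
      open ≡-Reasoning
      interchange : ∀ x y z u → x * y * (z * u) ≡ x * z * (y * u)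
      interchange = solve-∀

    row-sum : ∀ H → ∑P s (λ H′ → ω H * ω H′ * (θ r + δ H H′ * Q ^ r)) ≡ ω H * (m * θ r + Q ^ r)
    row-sum H = begin
      ∑P s (λ H′ → ω H * ω H′ * (θ r + δ H H′ * Q ^ r))
        ≡⟨ ∑P.∑-cong s (λ H′ → expand (ω H) (ω H′) (θ r) (δ H H′) (Q ^ r)) ⟩
      ∑P s (λ H′ → ω H * θ r * ω H′ + ω H * Q ^ r * (ω H′ * δ H H′))
        ≡⟨ ∑P.∑-distrib-+ s (λ H′ → ω H * θ r * ω H′) (λ H′ → ω H * Q ^ r * (ω H′ * δ H H′)) ⟩
      ∑P s (λ H′ → ω H * θ r * ω H′) + ∑P s (λ H′ → ω H * Q ^ r * (ω H′ * δ H H′))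
        ≡⟨ cong₂ _+_ (∑P.∑-distribˡ-* s (ω H * θ r) ω)
                     (trans (∑P.∑-distribˡ-* s (ω H * Q ^ r) (λ H′ → ω H′ * δ H H′))
                            (cong (ω H * Q ^ r *_) (∑-δ H))) ⟩
      ω H * θ r * m + ω H * Q ^ r * ω H
        ≡⟨ collect (ω H) (θ r) m (Q ^ r) ⟩
      ω H * (m * θ r) + Q ^ r * (ω H * ω H)
        ≡⟨ cong (λ n → ω H * (m * θ r) + Q ^ r * n) (𝟙-idem (T? (Ω H))) ⟩
      ω H * (m * θ r) + Q ^ r * ω H
        ≡⟨ factor (ω H) (m * θ r) (Q ^ r) ⟩
      ω H * (m * θ r + Q ^ r) ∎
      where
      open ≡-Reasoning
      expand : ∀ x y t d q → x * y * (t + d * q) ≡ x * t * y + x * q * (y * d)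
      expand = solve-∀
      collect : ∀ x t m q → x * t * m + x * q * x ≡ x * (m * t) + q * (x * x)
      collect = solve-∀
      factor : ∀ x n q → x * n + q * x ≡ x * (n + q)
      factor = solve-∀

    ∑-deg² : ∑P s (λ P → deg P * deg P) ≡ m * (m * θ r + Q ^ r)
    ∑-deg² = begin
      ∑P s (λ P → deg P * deg P)
        ≡⟨ ∑P.∑-cong s (λ P → trans (cong₂ _*_ (deg-≡-∑ι P) (deg-≡-∑ι P))
                                     (∑-*-∑ (∑P-isSum s) (∑P-isSum s) (λ H → ι H P) (λ H′ → ι H′ P))) ⟩
      ∑P s (λ P → ∑P s (λ H → ∑P s (λ H′ → ι H P * ι H′ P)))
        ≡⟨ ∑-comm (∑P-isSum s) (∑P-isSum s) (λ P H → ∑P s (λ H′ → ι H P * ι H′ P)) ⟩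
      ∑P s (λ H → ∑P s (λ P → ∑P s (λ H′ → ι H P * ι H′ P)))
        ≡⟨ ∑P.∑-cong s (λ H → ∑-comm (∑P-isSum s) (∑P-isSum s) (λ P H′ → ι H P * ι H′ P)) ⟩
      ∑P s (λ H → ∑P s (λ H′ → ∑P s (λ P → ι H P * ι H′ P)))
        ≡⟨ ∑P.∑-cong s (λ H → trans (∑P.∑-cong s (pair-count H)) (row-sum H)) ⟩
      ∑P s (λ H → ω H * (m * θ r + Q ^ r))
        ≡⟨ ∑P.∑-distribʳ-* s (m * θ r + Q ^ r) ω ⟩
      m * (m * θ r + Q ^ r) ∎
      where open ≡-Reasoning

    module TwoValued {a c : ℕ} (two-valued : ∀ P → deg P ≡ a ⊎ deg P ≡ c) where

      b w : ℕ
      b = ∑P s (λ P → 𝟙 (deg P ℕₚ.≟ a))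
      w = ∑P s (λ P → 𝟙 (¬? (deg P ℕₚ.≟ a)))

      black-points : Σ (Point s) (λ P → deg P ≡ a) ↔ Fin b
      black-points = ∑P.∑-𝟙 s (λ _ → ℕₚ.≡-irrelevant) (λ P → deg P ℕₚ.≟ a)

      b+w : b + w ≡ θ (suc s)
      b+w = begin
        b + w            ≡⟨ cong₂ _+_ (*-identityˡ b) (*-identityˡ w) ⟨
        1 * b + 1 * w    ≡⟨ ∑P.∑-two-valued s two-valued (λ _ → 1) ⟨
        ∑P s (λ _ → 1)   ≡⟨ points-count s ⟩
        θ (suc s)        ∎
        where open ≡-Reasoning

      ab+cw : a * b + c * w ≡ m * θ s
      ab+cw = trans (sym (∑P.∑-two-valued s two-valued (λ n → n))) ∑-deg

      a²b+c²w : a * a * b + c * c * w ≡ m * (m * θ r + Q ^ r)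
      a²b+c²w = trans (sym (∑P.∑-two-valued s two-valued (λ n → n * n))) ∑-deg²

module Arithmetic where

  open import Data.Bool.Base using (true; false)
  open import Data.Empty using (⊥-elim)
  open import Data.Integer.Base using (ℤ; +_; -[1+_]; 0ℤ; 1ℤ; -1ℤ; _+_; _*_; _-_; -_; ∣_∣; ≢-nonZero)
  import Data.Integer.Properties as ℤ
  open import Data.Integer.Divisibility.Signed using (_∣_; divides; ∣⇒∣ᵤ; ∣m∣n⇒∣m-n)
  open import Data.Integer.Tactic.RingSolver using (solve-∀)
  open import Data.Nat.Base using (_∸_; z≤n)
  open import Data.Nat.DivMod using (_/_; m*n/n≡m)
  open import Data.Nat.Divisibility using (∣⇒≤)
  import Data.Nat.Tactic.RingSolver as ℕ-Solver
  open import Data.Product.Base using (_,_)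
  open import Data.Sum.Base using (inj₁; inj₂; [_,_]′)
  open import Function.Base using (_∘_)
  open import Relation.Binary.PropositionalEquality
  open import Relation.Nullary using (contradiction; yes; no)

  Is±1 : ℤ → Set
  Is±1 σ = σ ≡ 1ℤ ⊎ σ ≡ -1ℤ

  infix 8 -1^_

  -1^_ : ℕ → ℤ
  -1^ zero  = 1ℤ
  -1^ suc n = - (-1^ n)

  -1^-is±1 : ∀ n → Is±1 (-1^ n)
  -1^-is±1 zero = inj₁ refl
  -1^-is±1 (suc n) with -1^ n | -1^-is±1 n
  ... | _ | inj₁ refl = inj₂ refl
  ... | _ | inj₂ refl = inj₁ refl

  -1^-≢0 : ∀ n → -1^ n ≢ 0ℤ
  -1^-≢0 n with -1^ n | -1^-is±1 n
  ... | _ | inj₁ refl = λ ()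
  ... | _ | inj₂ refl = λ ()

  T-σ≢0 : ∀ T → 2 ≤ T → ∀ {σ} → Is±1 σ → + T - σ ≢ 0ℤ
  T-σ≢0 (suc zero)    (s≤s ())
  T-σ≢0 (suc (suc T)) _ (inj₁ refl) = λ ()
  T-σ≢0 (suc (suc T)) _ (inj₂ refl) = λ ()

  two-valued-moments : ∀ A C B W →
    A * A * B + C * C * W - (A + C) * (A * B + C * W) + A * C * (B + W) ≡ 0ℤ
  two-valued-moments = solve-∀

  quadratic-scaled : ∀ z t M A C θ →
    (z * z - 1ℤ) * ((z + 1ℤ) * (z + 1ℤ))
      * (M * (M * θ + t * t) - (A + C) * (M * (θ + t * t)) + A * C * (θ + t * t + z * z * (t * t)))
    ≡ (z + 1ℤ) * (z + 1ℤ) * (M * M) * ((z * z - 1ℤ) * θ) + (z + 1ℤ) * (z + 1ℤ) * (z * z - 1ℤ) * M * (t * t)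
      - ((z + 1ℤ) * A + (z + 1ℤ) * C) * (z + 1ℤ) * M * ((z * z - 1ℤ) * θ + (z * z - 1ℤ) * (t * t))
      + (z + 1ℤ) * A * ((z + 1ℤ) * C) * ((z * z - 1ℤ) * θ + (z * z - 1ℤ) * (t * t + z * z * (t * t)))
  quadratic-scaled = solve-∀

  quadratic-factorisation : ∀ σ → Is±1 σ → ∀ z t M →
    (z + 1ℤ) * (z + 1ℤ) * (M * M) * (t * t - 1ℤ) + (z + 1ℤ) * (z + 1ℤ) * (z * z - 1ℤ) * M * (t * t)
      - (z * t * (t - σ) + t * (z * t + σ)) * (z + 1ℤ) * M * (t * t - 1ℤ + (z * z - 1ℤ) * (t * t))
      + z * t * (t - σ) * (t * (z * t + σ)) * (t * t - 1ℤ + (z * z - 1ℤ) * (t * t + z * z * (t * t)))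
    ≡ (t - σ) * (((z + 1ℤ) * M - z * t * (z * z * t - σ))
                 * ((z + 1ℤ) * (t + σ) * M - t * (z * z * t + σ) * (z * t + σ)))
  quadratic-factorisation _ (inj₁ refl) = solve-∀
  quadratic-factorisation _ (inj₂ refl) = solve-∀

  scaled-a-c : ∀ z t σ → z * t * (t - σ) - t * (z * t + σ) ≡ - σ * t * (z + 1ℤ)
  scaled-a-c = solve-∀

  eliminate-W : ∀ z A C B W →
    ((z + 1ℤ) * A - (z + 1ℤ) * C) * ((z * z - 1ℤ) * B)
    ≡ (z + 1ℤ) * (z * z - 1ℤ) * (A * B + C * W) - (z + 1ℤ) * C * ((z * z - 1ℤ) * (B + W))
  eliminate-W = solve-∀

  separate-θ : ∀ z t M C θ →
    (z + 1ℤ) * (z * z - 1ℤ) * (M * (θ + t * t))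
      - (z + 1ℤ) * C * ((z * z - 1ℤ) * (θ + t * t + z * z * (t * t)))
    ≡ (z + 1ℤ) * M * ((z * z - 1ℤ) * θ + (z * z - 1ℤ) * (t * t))
      - (z + 1ℤ) * C * ((z * z - 1ℤ) * θ + (z * z - 1ℤ) * (t * t + z * z * (t * t)))
  separate-θ = solve-∀

  first-root-factorisation : ∀ σ → Is±1 σ → ∀ z t →
    z * t * (z * z * t - σ) * (t * t - 1ℤ + (z * z - 1ℤ) * (t * t))
      - t * (z * t + σ) * (t * t - 1ℤ + (z * z - 1ℤ) * (t * t + z * z * (t * t)))
    ≡ - σ * t * (z + 1ℤ) * ((z * z * t - σ) * (z * t + σ))
  first-root-factorisation _ (inj₁ refl) = solve-∀
  first-root-factorisation _ (inj₂ refl) = solve-∀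

  -- With z = q, t = q^r, σ = (-1)^r for r = s - 1, the parameters A, C, θ, M, B, W stand for a, c,
  -- θ r, m, b, w, and hA, hC, hθ are the divisions defining a, c and θ r with denominators cleared.
  module QuadraticInM (z t σ : ℤ) (σ≡±1 : Is±1 σ) {A C θ M B W : ℤ}
    (hA : (z + 1ℤ) * A ≡ z * t * (t - σ)) (hC : (z + 1ℤ) * C ≡ t * (z * t + σ))
    (hθ : (z * z - 1ℤ) * θ ≡ t * t - 1ℤ)
    (e₀ : B + W ≡ θ + t * t + z * z * (t * t))
    (e₁ : A * B + C * W ≡ M * (θ + t * t))
    (e₂ : A * A * B + C * C * W ≡ M * (M * θ + t * t)) where

    F₁ F₂ : ℤ
    F₁ = (z + 1ℤ) * M - z * t * (z * z * t - σ)
    F₂ = (z + 1ℤ) * (t + σ) * M - t * (z * z * t + σ) * (z * t + σ)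

    quadratic≡0 : M * (M * θ + t * t) - (A + C) * (M * (θ + t * t)) + A * C * (θ + t * t + z * z * (t * t)) ≡ 0ℤ
    quadratic≡0 = begin
      M * (M * θ + t * t) - (A + C) * (M * (θ + t * t)) + A * C * (θ + t * t + z * z * (t * t))
        ≡⟨ cong₂ (λ x y → x - (A + C) * y + A * C * (θ + t * t + z * z * (t * t))) e₂ e₁ ⟨
      A * A * B + C * C * W - (A + C) * (A * B + C * W) + A * C * (θ + t * t + z * z * (t * t))
        ≡⟨ cong (λ x → A * A * B + C * C * W - (A + C) * (A * B + C * W) + A * C * x) e₀ ⟨
      A * A * B + C * C * W - (A + C) * (A * B + C * W) + A * C * (B + W)
        ≡⟨ two-valued-moments A C B W ⟩
      0ℤ ∎
      where open ≡-Reasoning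

    quadratic-factorises :
      (z * z - 1ℤ) * ((z + 1ℤ) * (z + 1ℤ))
        * (M * (M * θ + t * t) - (A + C) * (M * (θ + t * t)) + A * C * (θ + t * t + z * z * (t * t)))
      ≡ (t - σ) * (F₁ * F₂)
    quadratic-factorises = begin
      (z * z - 1ℤ) * ((z + 1ℤ) * (z + 1ℤ))
        * (M * (M * θ + t * t) - (A + C) * (M * (θ + t * t)) + A * C * (θ + t * t + z * z * (t * t)))
        ≡⟨ quadratic-scaled z t M A C θ ⟩
      G ((z + 1ℤ) * A) ((z + 1ℤ) * C) ((z * z - 1ℤ) * θ)
        ≡⟨ cong (λ a → G a ((z + 1ℤ) * C) ((z * z - 1ℤ) * θ)) hA ⟩
      G (z * t * (t - σ)) ((z + 1ℤ) * C) ((z * z - 1ℤ) * θ)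
        ≡⟨ cong (λ c → G (z * t * (t - σ)) c ((z * z - 1ℤ) * θ)) hC ⟩
      G (z * t * (t - σ)) (t * (z * t + σ)) ((z * z - 1ℤ) * θ)
        ≡⟨ cong (G (z * t * (t - σ)) (t * (z * t + σ))) hθ ⟩
      G (z * t * (t - σ)) (t * (z * t + σ)) (t * t - 1ℤ)
        ≡⟨ quadratic-factorisation σ σ≡±1 z t M ⟩
      (t - σ) * (F₁ * F₂) ∎
      where
      open ≡-Reasoning
      G : ℤ → ℤ → ℤ → ℤ
      G a c y = (z + 1ℤ) * (z + 1ℤ) * (M * M) * y + (z + 1ℤ) * (z + 1ℤ) * (z * z - 1ℤ) * M * (t * t)
                - (a + c) * (z + 1ℤ) * M * (y + (z * z - 1ℤ) * (t * t))
                + a * c * (y + (z * z - 1ℤ) * (t * t + z * z * (t * t)))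

    factor-vanishes : t - σ ≢ 0ℤ → F₁ ≡ 0ℤ ⊎ F₂ ≡ 0ℤ
    factor-vanishes t-σ≢0 =
      [ (λ t-σ≡0 → contradiction t-σ≡0 t-σ≢0) , ℤ.i*j≡0⇒i≡0∨j≡0 F₁ ]′
        (ℤ.i*j≡0⇒i≡0∨j≡0 (t - σ) t-σ*F₁F₂≡0)
      where
      D = (z * z - 1ℤ) * ((z + 1ℤ) * (z + 1ℤ))
      t-σ*F₁F₂≡0 : (t - σ) * (F₁ * F₂) ≡ 0ℤ
      t-σ*F₁F₂≡0 = trans (sym quadratic-factorises) (trans (cong (D *_) quadratic≡0) (ℤ.*-zeroʳ D))

    first-root⇒b : - σ * t * (z + 1ℤ) ≢ 0ℤ → F₁ ≡ 0ℤ → (z * z - 1ℤ) * B ≡ (z * z * t - σ) * (z * t + σ)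
    first-root⇒b k≢0 F₁≡0 =
      ℤ.*-cancelˡ-≡ (- σ * t * (z + 1ℤ)) ((z * z - 1ℤ) * B) ((z * z * t - σ) * (z * t + σ))
        {{≢-nonZero k≢0}} (begin
      - σ * t * (z + 1ℤ) * ((z * z - 1ℤ) * B)
        ≡⟨ cong (_* ((z * z - 1ℤ) * B)) (trans (cong₂ _-_ hA hC) (scaled-a-c z t σ)) ⟨
      ((z + 1ℤ) * A - (z + 1ℤ) * C) * ((z * z - 1ℤ) * B)
        ≡⟨ eliminate-W z A C B W ⟩
      (z + 1ℤ) * (z * z - 1ℤ) * (A * B + C * W) - (z + 1ℤ) * C * ((z * z - 1ℤ) * (B + W))
        ≡⟨ cong₂ (λ x y → (z + 1ℤ) * (z * z - 1ℤ) * x - (z + 1ℤ) * C * ((z * z - 1ℤ) * y)) e₁ e₀ ⟩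
      (z + 1ℤ) * (z * z - 1ℤ) * (M * (θ + t * t))
        - (z + 1ℤ) * C * ((z * z - 1ℤ) * (θ + t * t + z * z * (t * t)))
        ≡⟨ separate-θ z t M C θ ⟩
      H ((z + 1ℤ) * M) ((z + 1ℤ) * C) ((z * z - 1ℤ) * θ)
        ≡⟨ cong (λ m → H m ((z + 1ℤ) * C) ((z * z - 1ℤ) * θ))
                (ℤ.i-j≡0⇒i≡j ((z + 1ℤ) * M) (z * t * (z * z * t - σ)) F₁≡0) ⟩
      H (z * t * (z * z * t - σ)) ((z + 1ℤ) * C) ((z * z - 1ℤ) * θ)
        ≡⟨ cong (λ c → H (z * t * (z * z * t - σ)) c ((z * z - 1ℤ) * θ)) hC ⟩
      H (z * t * (z * z * t - σ)) (t * (z * t + σ)) ((z * z - 1ℤ) * θ)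
        ≡⟨ cong (H (z * t * (z * z * t - σ)) (t * (z * t + σ))) hθ ⟩
      H (z * t * (z * z * t - σ)) (t * (z * t + σ)) (t * t - 1ℤ)
        ≡⟨ first-root-factorisation σ σ≡±1 z t ⟩
      - σ * t * (z + 1ℤ) * ((z * z * t - σ) * (z * t + σ)) ∎)
      where
      open ≡-Reasoning
      H : ℤ → ℤ → ℤ → ℤ
      H m c y = m * (y + (z * z - 1ℤ) * (t * t)) - c * (y + (z * z - 1ℤ) * (t * t + z * z * (t * t)))

  ∣⇒∣-∣≤∣-∣ : ∀ {k i} → k ∣ i → i ≢ 0ℤ → ∣ k ∣ ≤ ∣ i ∣
  ∣⇒∣-∣≤∣-∣ k∣i i≢0 = ∣⇒≤ {{≢-nonZero i≢0}} (∣⇒∣ᵤ k∣i)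

  ∸1≤∣+σ∣ : ∀ T {σ} → Is±1 σ → T ∸ 1 ≤ ∣ + T + σ ∣
  ∸1≤∣+σ∣ T       (inj₁ refl) = ℕₚ.≤-trans (ℕₚ.m∸n≤m T 1) (ℕₚ.m≤m+n T 1)
  ∸1≤∣+σ∣ zero    (inj₂ refl) = z≤n
  ∸1≤∣+σ∣ (suc T) (inj₂ refl) = ℕₚ.≤-refl

  -- Modulo t + σ we have t ≡ -σ, which turns t (z² t + σ)(z t + σ) into -σ (z - 1)²(z + 1).
  second-root-divides : ∀ σ → Is±1 σ → ∀ z t M →
    (z + 1ℤ) * (t + σ) * M ≡ t * (z * z * t + σ) * (z * t + σ) → (t + σ) ∣ (z - 1ℤ) * (z - 1ℤ) * (z + 1ℤ)
  second-root-divides σ σ≡±1 z t M F₂≡0 = divides (σ * K) (begin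
    (z - 1ℤ) * (z - 1ℤ) * (z + 1ℤ)
      ≡⟨ remainder σ σ≡±1 z t M ⟩
    σ * K * (t + σ) + σ * ((z + 1ℤ) * (t + σ) * M - t * (z * z * t + σ) * (z * t + σ))
      ≡⟨ cong (λ x → σ * K * (t + σ) + σ * x) (ℤ.i≡j⇒i-j≡0 F₂≡0) ⟩
    σ * K * (t + σ) + σ * 0ℤ
      ≡⟨ cong (λ x → σ * K * (t + σ) + x) (ℤ.*-zeroʳ σ) ⟩
    σ * K * (t + σ) + 0ℤ
      ≡⟨ ℤ.+-identityʳ (σ * K * (t + σ)) ⟩
    σ * K * (t + σ) ∎)
    where
    open ≡-Reasoning
    K = z * z * z * (t * t) + σ * (z * z + z - z * z * z) * t + (z - 1ℤ) * (z - 1ℤ) * (z + 1ℤ) - (z + 1ℤ) * M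
    remainder : ∀ σ → Is±1 σ → ∀ z t M →
      (z - 1ℤ) * (z - 1ℤ) * (z + 1ℤ)
      ≡ σ * (z * z * z * (t * t) + σ * (z * z + z - z * z * z) * t + (z - 1ℤ) * (z - 1ℤ) * (z + 1ℤ) - (z + 1ℤ) * M)
            * (t + σ)
        + σ * ((z + 1ℤ) * (t + σ) * M - t * (z * z * t + σ) * (z * t + σ))
    remainder _ (inj₁ refl) = solve-∀
    remainder _ (inj₂ refl) = solve-∀

  [q-1]²[q+1]<q³∸1 : ∀ p → suc p ℕ.* suc p ℕ.* (suc (suc p) ℕ.+ 1) < suc (suc p) ^ 3 ∸ 1
  [q-1]²[q+1]<q³∸1 p = subst (suc p ℕ.* suc p ℕ.* (suc (suc p) ℕ.+ 1) <_) (sym (cong (_∸ 1) (cube p)))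
    (s≤s (ℕₚ.m≤m+n _ (p ℕ.* p ℕ.+ 5 ℕ.* p ℕ.+ 3)))
    where
    cube : ∀ p → (2 ℕ.+ p) ℕ.* ((2 ℕ.+ p) ℕ.* ((2 ℕ.+ p) ℕ.* 1))
                 ≡ 2 ℕ.+ ((1 ℕ.+ p) ℕ.* (1 ℕ.+ p) ℕ.* ((2 ℕ.+ p) ℕ.+ 1) ℕ.+ (p ℕ.* p ℕ.+ 5 ℕ.* p ℕ.+ 3))
    cube = ℕ-Solver.solve-∀

  2[q-1]<q²+1 : ∀ p → suc p ℕ.+ suc p < suc (suc p) ^ 2 ℕ.+ 1
  2[q-1]<q²+1 p = subst (suc p ℕ.+ suc p <_) (sym (square p)) (s≤s (ℕₚ.m≤m+n _ (p ℕ.* p ℕ.+ 2 ℕ.* p ℕ.+ 2)))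
    where
    square : ∀ p → (2 ℕ.+ p) ℕ.* ((2 ℕ.+ p) ℕ.* 1) ℕ.+ 1
                   ≡ 1 ℕ.+ ((1 ℕ.+ p) ℕ.+ (1 ℕ.+ p) ℕ.+ (p ℕ.* p ℕ.+ 2 ℕ.* p ℕ.+ 2))
    square = ℕ-Solver.solve-∀

  -- For r ≥ 3 the divisor t + σ is too large.  For r = 2, where t + σ = q² + 1, it also divides
  -- (q² + 1)(q - 1), hence the difference 2 (q - 1), which is too small.
  second-root-impossible : ∀ q r M → 2 ≤ q → 2 ≤ r →
    (+ q + 1ℤ) * (+ (q ^ r) + -1^ r) * M ≢ + (q ^ r) * (+ q * + q * + (q ^ r) + -1^ r) * (+ q * + (q ^ r) + -1^ r)
  second-root-impossible (suc zero) r M (s≤s ()) r≥2 F₂≡0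
  second-root-impossible q@(suc (suc p)) r M _ r≥2 F₂≡0 with r ℕₚ.≟ 2
  ... | yes refl = ℕₚ.<⇒≱ (2[q-1]<q²+1 p) (∣⇒∣-∣≤∣-∣ t+1∣2[z-1] λ ())
    where
    z = + q
    t = + (q ^ 2)
    t≡z² : t ≡ z * z
    t≡z² = cong (λ n → + (q ℕ.* n)) (ℕₚ.*-identityʳ q)
    difference : ∀ z → (z * z + 1ℤ) * (z - 1ℤ) - (z - 1ℤ) * (z - 1ℤ) * (z + 1ℤ) ≡ (z - 1ℤ) + (z - 1ℤ)
    difference = solve-∀
    t+1∣2[z-1] : (t + 1ℤ) ∣ (z - 1ℤ) + (z - 1ℤ)
    t+1∣2[z-1] =
      subst ((t + 1ℤ) ∣_)
        (trans (cong (λ x → (x + 1ℤ) * (z - 1ℤ) - (z - 1ℤ) * (z - 1ℤ) * (z + 1ℤ)) t≡z²) (difference z))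
        (∣m∣n⇒∣m-n (divides (z - 1ℤ) (ℤ.*-comm (t + 1ℤ) (z - 1ℤ)))
                   (second-root-divides 1ℤ (inj₁ refl) z t M F₂≡0))
  ... | no r≢2 =
    ℕₚ.<⇒≱ R<∣t+σ∣
      (∣⇒∣-∣≤∣-∣ (second-root-divides (-1^ r) (-1^-is±1 r) (+ q) (+ (q ^ r)) M F₂≡0) λ ())
    where
    R<∣t+σ∣ : suc p ℕ.* suc p ℕ.* (q ℕ.+ 1) < ∣ + (q ^ r) + -1^ r ∣
    R<∣t+σ∣ = ℕₚ.<-≤-trans ([q-1]²[q+1]<q³∸1 p)
      (ℕₚ.≤-trans (ℕₚ.∸-monoˡ-≤ 1 (ℕₚ.^-monoʳ-≤ q (ℕₚ.≤∧≢⇒< r≥2 (r≢2 ∘ sym))))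
                  (∸1≤∣+σ∣ (q ^ r) (-1^-is±1 r)))

  parity : ∀ n → (isEven n ≡ true × -1^ n ≡ 1ℤ) ⊎ (isEven n ≡ false × -1^ n ≡ -1ℤ)
  parity zero = inj₁ (refl , refl)
  parity (suc n) with isEven n | -1^ n | parity n
  ... | _ | _ | inj₁ (refl , refl) = inj₂ (refl , refl)
  ... | _ | _ | inj₂ (refl , refl) = inj₁ (refl , refl)

  qm-ℤ : ∀ q n → 1 ≤ q → + qm q n ≡ + (q ^ n) - -1^ n
  qm-ℤ q n q≥1 with isEven n | -1^ n | parity n
  ... | _ | _ | inj₁ (refl , refl) = sym (ℤ.⊖-≥ (ℕₚ.m^n>0 q {{ℕ.>-nonZero q≥1}} n))
  ... | _ | _ | inj₂ (refl , refl) = refl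

  alternatingSum : ℕ → ℕ → ℤ
  alternatingSum q zero    = 0ℤ
  alternatingSum q (suc n) = + (q ^ n) - alternatingSum q n

  [q+1]*alternatingSum : ∀ q n → (+ q + 1ℤ) * alternatingSum q n ≡ + (q ^ n) - -1^ n
  [q+1]*alternatingSum q zero    = ℤ.*-zeroʳ (+ q + 1ℤ)
  [q+1]*alternatingSum q (suc n) = begin
    (+ q + 1ℤ) * (+ (q ^ n) - alternatingSum q n)            ≡⟨ distrib (+ q) (+ (q ^ n)) (alternatingSum q n) ⟩
    (+ q + 1ℤ) * + (q ^ n) - (+ q + 1ℤ) * alternatingSum q n
      ≡⟨ cong (λ x → (+ q + 1ℤ) * + (q ^ n) - x) ([q+1]*alternatingSum q n) ⟩
    (+ q + 1ℤ) * + (q ^ n) - (+ (q ^ n) - -1^ n)             ≡⟨ cancel (+ q) (+ (q ^ n)) (-1^ n) ⟩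
    + q * + (q ^ n) - - -1^ n                                ≡⟨ cong (_- - -1^ n) (ℤ.pos-* q (q ^ n)) ⟨
    + (q ^ suc n) - -1^ suc n                                ∎
    where
    open ≡-Reasoning
    distrib : ∀ z x a → (z + 1ℤ) * (x - a) ≡ (z + 1ℤ) * x - (z + 1ℤ) * a
    distrib = solve-∀
    cancel : ∀ z x σ → (z + 1ℤ) * x - (x - σ) ≡ z * x - - σ
    cancel = solve-∀

  /-exact : ∀ x d .{{_ : ℕ.NonZero d}} k → + x ≡ + d * k → + (x / d) ≡ k
  /-exact x d@(suc _) (+ k) x≡d*k = cong +_ (trans (cong (_/ d) x≡k*d) (m*n/n≡m k d))
    where
    x≡k*d : x ≡ k ℕ.* d
    x≡k*d = trans (ℤ.+-injective (trans x≡d*k (sym (ℤ.pos-* d k)))) (ℕₚ.*-comm d k)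
  /-exact x (suc _) -[1+ _ ] ()

  [q+1]*qm/[q+1] : ∀ q n x → 1 ≤ q → (+ q + 1ℤ) * + ((x ℕ.* qm q n) / suc q) ≡ + x * (+ (q ^ n) - -1^ n)
  [q+1]*qm/[q+1] q n x q≥1 = begin
    (+ q + 1ℤ) * + ((x ℕ.* qm q n) / suc q) ≡⟨ cong ((+ q + 1ℤ) *_) (/-exact _ (suc q) _ x*qm≡) ⟩
    (+ q + 1ℤ) * (+ x * alternatingSum q n) ≡⟨ swap (+ q) (+ x) (alternatingSum q n) ⟩
    + x * ((+ q + 1ℤ) * alternatingSum q n) ≡⟨ cong (+ x *_) ([q+1]*alternatingSum q n) ⟩
    + x * (+ (q ^ n) - -1^ n)               ∎
    where
    open ≡-Reasoning
    swap : ∀ z x a → (z + 1ℤ) * (x * a) ≡ x * ((z + 1ℤ) * a)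
    swap = solve-∀
    x*qm≡ : + (x ℕ.* qm q n) ≡ + suc q * (+ x * alternatingSum q n)
    x*qm≡ = begin
      + (x ℕ.* qm q n)                        ≡⟨ ℤ.pos-* x (qm q n) ⟩
      + x * + qm q n                          ≡⟨ cong (+ x *_) (trans (qm-ℤ q n q≥1) (sym ([q+1]*alternatingSum q n))) ⟩
      + x * ((+ q + 1ℤ) * alternatingSum q n) ≡⟨ swap (+ q) (+ x) (alternatingSum q n) ⟨
      (+ q + 1ℤ) * (+ x * alternatingSum q n) ≡⟨ cong (λ k → + k * (+ x * alternatingSum q n)) (ℕₚ.+-comm q 1) ⟩
      + suc q * (+ x * alternatingSum q n)    ∎

  geometricSum-ℤ : ∀ Q k → (+ Q - 1ℤ) * + geometricSum Q k ≡ + (Q ^ k) - 1ℤ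
  geometricSum-ℤ Q zero    = ℤ.*-zeroʳ (+ Q - 1ℤ)
  geometricSum-ℤ Q (suc k) = begin
    (+ Q - 1ℤ) * (+ geometricSum Q k + + (Q ^ k))        ≡⟨ distrib (+ Q) (+ geometricSum Q k) (+ (Q ^ k)) ⟩
    (+ Q - 1ℤ) * + geometricSum Q k + (+ Q - 1ℤ) * + (Q ^ k)
      ≡⟨ cong (_+ (+ Q - 1ℤ) * + (Q ^ k)) (geometricSum-ℤ Q k) ⟩
    + (Q ^ k) - 1ℤ + (+ Q - 1ℤ) * + (Q ^ k)              ≡⟨ collect (+ Q) (+ (Q ^ k)) ⟩
    + Q * + (Q ^ k) - 1ℤ                                 ≡⟨ cong (_- 1ℤ) (ℤ.pos-* Q (Q ^ k)) ⟨
    + (Q ^ suc k) - 1ℤ                                   ∎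
    where
    open ≡-Reasoning
    distrib : ∀ z a b → (z - 1ℤ) * (a + b) ≡ (z - 1ℤ) * a + (z - 1ℤ) * b
    distrib = solve-∀
    collect : ∀ z x → x - 1ℤ + (z - 1ℤ) * x ≡ z * x - 1ℤ
    collect = solve-∀

  module _ (q r : ℕ) where

    private
      z t σ : ℤ
      z = + q
      t = + (q ^ r)
      σ = -1^ r
      Q = q ^ 2
      θ = geometricSum Q
      a = blackCount q (suc r)
      c = otherCount q (suc r)

    Q≡z² : + Q ≡ z * z
    Q≡z² = trans (cong (λ n → + (q ℕ.* n)) (ℕₚ.*-identityʳ q)) (ℤ.pos-* q q)

    Qʳ≡t² : + (Q ^ r) ≡ t * t
    Qʳ≡t² = trans (cong +_ Qʳ≡qʳqʳ) (ℤ.pos-* (q ^ r) (q ^ r))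
      where
      Qʳ≡qʳqʳ : Q ^ r ≡ q ^ r ℕ.* q ^ r
      Qʳ≡qʳqʳ = trans (ℕₚ.^-*-assoc q 2 r)
        (trans (ℕₚ.^-distribˡ-+-* q r (r ℕ.+ 0)) (cong (λ k → q ^ r ℕ.* q ^ k) (ℕₚ.+-identityʳ r)))

    Qʳ⁺¹≡z²t² : + (Q ^ suc r) ≡ z * z * (t * t)
    Qʳ⁺¹≡z²t² = trans (ℤ.pos-* Q (Q ^ r)) (cong₂ _*_ Q≡z² Qʳ≡t²)

    θ-ℤ : (z * z - 1ℤ) * + θ r ≡ t * t - 1ℤ
    θ-ℤ = subst₂ (λ x y → (x - 1ℤ) * + θ r ≡ y - 1ℤ) Q≡z² Qʳ≡t² (geometricSum-ℤ Q r)

    blackCount-ℤ : 1 ≤ q → (z + 1ℤ) * + a ≡ z * t * (t - σ)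
    blackCount-ℤ q≥1 = trans ([q+1]*qm/[q+1] q r (q ^ suc r) q≥1) (cong (_* (t - σ)) (ℤ.pos-* q (q ^ r)))

    otherCount-ℤ : 1 ≤ q → (z + 1ℤ) * + c ≡ t * (z * t + σ)
    otherCount-ℤ q≥1 = trans ([q+1]*qm/[q+1] q (suc r) (q ^ r) q≥1)
      (cong (t *_) (cong₂ _+_ (ℤ.pos-* q (q ^ r)) (ℤ.neg-involutive σ)))

    b+w-ℤ : ∀ {b w} → b ℕ.+ w ≡ θ (suc (suc r)) → + b + + w ≡ + θ r + t * t + z * z * (t * t)
    b+w-ℤ b+w = trans (cong +_ b+w) (cong₂ (λ x y → + θ r + x + y) Qʳ≡t² Qʳ⁺¹≡z²t²)

    ab+cw-ℤ : ∀ {m b w} → a ℕ.* b ℕ.+ c ℕ.* w ≡ m ℕ.* θ (suc r) →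
              + a * + b + + c * + w ≡ + m * (+ θ r + t * t)
    ab+cw-ℤ {m} {b} {w} ab+cw = begin
      + a * + b + + c * + w    ≡⟨ cong₂ _+_ (ℤ.pos-* a b) (ℤ.pos-* c w) ⟨
      + (a ℕ.* b ℕ.+ c ℕ.* w)  ≡⟨ cong +_ ab+cw ⟩
      + (m ℕ.* θ (suc r))      ≡⟨ ℤ.pos-* m (θ (suc r)) ⟩
      + m * + θ (suc r)        ≡⟨ cong (λ x → + m * (+ θ r + x)) Qʳ≡t² ⟩
      + m * (+ θ r + t * t)    ∎
      where open ≡-Reasoning

    a²b+c²w-ℤ : ∀ {m b w} → a ℕ.* a ℕ.* b ℕ.+ c ℕ.* c ℕ.* w ≡ m ℕ.* (m ℕ.* θ r ℕ.+ Q ^ r) →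
                + a * + a * + b + + c * + c * + w ≡ + m * (+ m * + θ r + t * t)
    a²b+c²w-ℤ {m} {b} {w} a²b+c²w = begin
      + a * + a * + b + + c * + c * + w
        ≡⟨ cong₂ _+_ (trans (ℤ.pos-* (a ℕ.* a) b) (cong (_* + b) (ℤ.pos-* a a)))
                     (trans (ℤ.pos-* (c ℕ.* c) w) (cong (_* + w) (ℤ.pos-* c c))) ⟨
      + (a ℕ.* a ℕ.* b ℕ.+ c ℕ.* c ℕ.* w)  ≡⟨ cong +_ a²b+c²w ⟩
      + (m ℕ.* (m ℕ.* θ r ℕ.+ Q ^ r))      ≡⟨ ℤ.pos-* m (m ℕ.* θ r ℕ.+ Q ^ r) ⟩
      + m * + (m ℕ.* θ r ℕ.+ Q ^ r)        ≡⟨ cong (λ x → + m * (x + + (Q ^ r))) (ℤ.pos-* m (θ r)) ⟩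
      + m * (+ m * + θ r + + (Q ^ r))      ≡⟨ cong (λ x → + m * (+ m * + θ r + x)) Qʳ≡t² ⟩
      + m * (+ m * + θ r + t * t)          ∎
      where open ≡-Reasoning

    t-σ≢0 : 2 ≤ q → 1 ≤ r → t - σ ≢ 0ℤ
    t-σ≢0 q≥2 r≥1 = T-σ≢0 (q ^ r) (ℕₚ.≤-trans q≥2 q≤qʳ) (-1^-is±1 r)
      where
      q≤qʳ : q ≤ q ^ r
      q≤qʳ = ℕₚ.≤-trans (ℕₚ.≤-reflexive (sym (ℕₚ.^-identityʳ q)))
                         (ℕₚ.^-monoʳ-≤ q {{ℕ.>-nonZero (ℕₚ.≤-trans (s≤s z≤n) q≥2)}} r≥1)

    -σt[z+1]≢0 : 1 ≤ q → - σ * t * (z + 1ℤ) ≢ 0ℤ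
    -σt[z+1]≢0 q≥1 =
      [ [ -1^-≢0 (suc r) , t≢0 ]′ ∘ ℤ.i*j≡0⇒i≡0∨j≡0 (- σ) , z+1≢0 ]′ ∘ ℤ.i*j≡0⇒i≡0∨j≡0 (- σ * t)
      where
      t≢0 : t ≢ 0ℤ
      t≢0 t≡0 = ℕₚ.<⇒≢ (ℕₚ.m^n>0 q {{ℕ.>-nonZero q≥1}} r) (sym (ℤ.+-injective t≡0))
      z+1≢0 : z + 1ℤ ≢ 0ℤ
      z+1≢0 z+1≡0 = ℕₚ.0≢1+n (sym (trans (ℕₚ.+-comm 1 q) (ℤ.+-injective z+1≡0)))

    b≡N : 2 ≤ q → ∀ b → (z * z - 1ℤ) * + b ≡ (z * z * t - σ) * (z * t + σ) → b ≡ N q (suc r)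
    b≡N q≥2@(s≤s (s≤s _)) b eq = sym (trans (cong (_/ (q ℕ.* q ∸ 1)) numerator≡) (m*n/n≡m b (q ℕ.* q ∸ 1)))
      where
      q≥1 = ℕₚ.≤-trans (s≤s z≤n) q≥2
      qm[r+2]-ℤ : + qm q (suc (suc r)) ≡ z * z * t - σ
      qm[r+2]-ℤ = trans (qm-ℤ q (suc (suc r)) q≥1)
        (cong₂ _-_ (trans (ℤ.pos-* q (q ^ suc r)) (trans (cong (z *_) (ℤ.pos-* q (q ^ r))) (sym (ℤ.*-assoc z z t))))
                   (ℤ.neg-involutive σ))
      qm[r+1]-ℤ : + qm q (suc r) ≡ z * t + σ
      qm[r+1]-ℤ = trans (qm-ℤ q (suc r) q≥1) (cong₂ _+_ (ℤ.pos-* q (q ^ r)) (ℤ.neg-involutive σ))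
      z²-1≡ : z * z - 1ℤ ≡ + (q ℕ.* q ∸ 1)
      z²-1≡ = trans (cong (_- 1ℤ) (sym (ℤ.pos-* q q))) (ℤ.⊖-≥ (ℕₚ.*-mono-≤ q≥1 q≥1))
      numerator≡ : qm q (suc (suc r)) ℕ.* qm q (suc r) ≡ b ℕ.* (q ℕ.* q ∸ 1)
      numerator≡ = ℤ.+-injective (begin
        + (qm q (suc (suc r)) ℕ.* qm q (suc r)) ≡⟨ ℤ.pos-* (qm q (suc (suc r))) (qm q (suc r)) ⟩
        + qm q (suc (suc r)) * + qm q (suc r)   ≡⟨ cong₂ _*_ qm[r+2]-ℤ qm[r+1]-ℤ ⟩
        (z * z * t - σ) * (z * t + σ)           ≡⟨ eq ⟨
        (z * z - 1ℤ) * + b                      ≡⟨ cong (_* + b) z²-1≡ ⟩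
        + (q ℕ.* q ∸ 1) * + b                   ≡⟨ ℤ.*-comm (+ (q ℕ.* q ∸ 1)) (+ b) ⟩
        + b * + (q ℕ.* q ∸ 1)                   ≡⟨ ℤ.pos-* b (q ℕ.* q ∸ 1) ⟨
        + (b ℕ.* (q ℕ.* q ∸ 1))                 ∎)
        where open ≡-Reasoning

    black-count : 2 ≤ q → 2 ≤ r → ∀ {m b w} →
      b ℕ.+ w ≡ θ (suc (suc r)) →
      a ℕ.* b ℕ.+ c ℕ.* w ≡ m ℕ.* θ (suc r) →
      a ℕ.* a ℕ.* b ℕ.+ c ℕ.* c ℕ.* w ≡ m ℕ.* (m ℕ.* θ r ℕ.+ Q ^ r) →
      b ≡ N q (suc r)
    black-count q≥2 r≥2 {m} {b} {w} b+w ab+cw a²b+c²w =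
      [ b≡N q≥2 b ∘ first-root⇒b (-σt[z+1]≢0 q≥1)
      , ⊥-elim ∘ second-root-impossible q r (+ m) q≥2 r≥2 ∘ ℤ.i-j≡0⇒i≡j _ _
      ]′ (factor-vanishes (t-σ≢0 q≥2 (ℕₚ.≤-trans (s≤s z≤n) r≥2)))
      where
      q≥1 = ℕₚ.≤-trans (s≤s z≤n) q≥2
      open QuadraticInM z t σ (-1^-is±1 r) {+ a} {+ c} {+ θ r} {+ m} {+ b} {+ w}
        (blackCount-ℤ q≥1) (otherCount-ℤ q≥1) θ-ℤ
        (b+w-ℤ {b} {w} b+w) (ab+cw-ℤ {m} ab+cw) (a²b+c²w-ℤ {m} a²b+c²w)

open Arithmetic using (black-count)

mainTheorem7 :
    (q s : ℕ) → IsPrimePower q → 2 < q → 3 ≤ s →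
    (F : Field) → HasSize (Field.Carrier F) (q ^ 2) →
    let open Projective F in
    (Ω : Hyperplane s → Bool) →
    Σ (Hyperplane s) (λ H → T (Ω H)) →
    (deg : Point s → ℕ) →
    (∀ P → HasSize (Σ (Hyperplane s) (λ H → T (Ω H) × P ∈H H)) (deg P)) →
    (∀ P → deg P ≡ blackCount q s ⊎ deg P ≡ otherCount q s) →
    HasSize (Σ (Point s) (λ P → deg P ≡ blackCount q s)) (N q s)
mainTheorem7 q (suc r) _ 2<q (s≤s 2≤r) F |F| Ω _ deg deg-counts two-valued =
  subst (HasSize _) (black-count q r (ℕₚ.<⇒≤ 2<q) 2≤r {m} {b} {w} b+w ab+cw a²b+c²w) black-points
  where
  open ProjectiveCounting F |F|
  open DoubleCounting Ω deg deg-counts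
  open TwoValued two-valued
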